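{- Let $f:2^V\to\mathbb{R}$ be a submodular function with $f(\emptyset)=0$, let $y\in B(f)$ be a $(\delta,k)$ dual certificate for $f$, given with a representation $y=\sum_{t\in[m]}\alpha_t g_{\pi_t}$ ($\alpha$ in the probability simplex on $[m]$, $\pi_t$ permutations of $V$), and let $P\subseteq V$. Then $y_{\leftarrow P}\in B(f_P)$. Moreover, if $P\subseteq S^*$ for some $k$-sparse minimizer $S^*$ of $f$, then $y(P)\le\delta$ and $y_{\leftarrow P}$ is a $(\delta-y(P),k)$ dual certificate for $f_P$.
   Context: For a bijection $\pi:[n]\to V$ ($n=|V|$), $\pi[i]=\{\pi(1),\dots,\pi(i)\}$, $\pi[0]=\emptyset$, and $g_\pi\in\mathbb{R}^V$ is given by $(g_\pi)_{\pi(i)}=f(\pi[i])-f(\pi[i-1])$. The base polytope is $B(f)=\{y\in\mathbb{R}^V: y(S)\le f(S)\ \forall S\subseteq V,\ y(V)=f(V)\}$, where $y(S)=\sum_{p\in S}y_p$. For $P\subseteq V$, $\pi_{\leftarrow P}$ is the permutation obtained from $\pi$ by moving the elements of $P$ to the front, preserving the relative order within $P$ and within $V\setminus P$. Given the representation of $y$, $y_{\leftarrow P}\in\mathbb{R}^{V\setminus P}$ is the restriction to $V\setminus P$ of $\sum_t\alpha_t g_{(\pi_t)_{\leftarrow P}}$. The contracted function $f_P:2^{V\setminus P}\to\mathbb{R}$ is $f_P(S)=f(S\cup P)-f(P)$. For a set function $h$ on ground set $U$, $h^*=\min_{S\subseteq U}h(S)$; for $y\in\mathbb{R}^U$, $y^\ell_-(U)$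 is the sum of the $\ell$ most negative coordinates of $\min\{y,0\}$. $y\in\mathbb{R}^U$ is a $(\delta,k)$ dual certificate for $h$ if (1) $h^*\le y^{k+1}_-(U)+\delta$ and (2) $h(S)\ge y(S)$ for all $S\subseteq U$ with $|S|\le k$. A $k$-sparse minimizer is a minimizer of size at most $k$. -}

module Defs where

open import Data.Bool.Base using (Bool; true; false; if_then_else_)
open import Data.Nat.Base as ℕ using (ℕ; zero; suc)
open import Data.Fin.Base using (Fin)
open import Data.Fin.Properties using () renaming (_≟_ to _≟ᶠ_)
open import Data.Fin.Subset using (Subset; _⊆_; _∪_; _∩_; ∁; ⁅_⁆; ⊥; ⊤; ∣_∣)
open import Data.Fin.Subset.Properties using (_∈?_; _⊆?_)
open import Data.List.Base using (List; []; _∷_; _++_; map; filter; take; foldr; allFin)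
open import Data.List.Relation.Binary.Permutation.Propositional using (_↭_)
open import Data.Vec.Base using ([]; _∷_)
open import Data.Product using (_×_; Σ; ∃)
open import Relation.Nullary using (¬_; does; Dec)
open import Relation.Binary.PropositionalEquality using (_≡_; _≢_)
open import Relation.Binary.Structures using (IsDecTotalOrder)
open import Relation.Binary.Bundles using (DecTotalOrder)
open import Algebra.Structures using (IsCommutativeRing)
import Data.List.Sort

-- The scalars.  The paper works over ℝ, which agda-stdlib lacks; we
-- work over an arbitrary (discrete, i.e. decidably totally) ordered
-- field, of which ℝ (classically) is an instance.

record OrderedField : Set₁ where
  infixl 6 _+_
  infixl 7 _*_
  infix  4 _≤_
  field
    R        : Set
    _+_ _*_  : R → R → R
    -_       : R → R
    0# 1#    : R
    _≤_      : R → R → Set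
    isCommutativeRing : IsCommutativeRing _≡_ _+_ _*_ -_ 0# 1#
    isDecTotalOrder   : IsDecTotalOrder _≡_ _≤_
    0≢1      : 0# ≢ 1#
    inverse  : ∀ x → x ≢ 0# → Σ R (λ x⁻¹ → x * x⁻¹ ≡ 1#)
    +-mono-≤ : ∀ {x y} z → x ≤ y → x + z ≤ y + z
    *-nonneg : ∀ {x y} → 0# ≤ x → 0# ≤ y → 0# ≤ x * y

  _-_ : R → R → R
  x - y = x + (- y)

  decTotalOrder : DecTotalOrder _ _ _
  decTotalOrder = record { isDecTotalOrder = isDecTotalOrder }

  _≤?_ : ∀ x y → Dec (x ≤ y)
  _≤?_ = IsDecTotalOrder._≤?_ isDecTotalOrder

  _⊓_ : R → R → R
  x ⊓ y = if does (x ≤? y) then x else y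

  sumL : List R → R
  sumL = foldr _+_ 0#

elems : ∀ {n} → Subset n → List (Fin n)
elems {n} S = filter (_∈? S) (allFin n)

allSubsets : ∀ n → List (Subset n)
allSubsets zero    = [] ∷ []
allSubsets (suc n) = map (false ∷_) (allSubsets n) ++ map (true ∷_) (allSubsets n)

subsetsOf : ∀ {n} → Subset n → List (Subset n)
subsetsOf {n} U = filter (_⊆? U) (allSubsets n)

-- A permutation of V, i.e. a bijection π : [n] → V, is represented by the
-- list  π(1) ∷ π(2) ∷ … ∷ π(n)  (required to be a permutation of allFin n).

moveFront : ∀ {n} → Subset n → List (Fin n) → List (Fin n)
moveFront P π = filter (_∈? P) π ++ filter (λ p → Relation.Nullary.¬? (p ∈? P)) π

module _ (F : OrderedField) where
  open OrderedField F

  vsum : ∀ {n} → (Fin n → R) → Subset n → R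
  vsum y S = sumL (map y (elems S))

  fsum : ∀ {m} → (Fin m → R) → R
  fsum {m} a = sumL (map a (allFin m))

  -- g_π for π given as a list; `acc` is the prefix set π[i-1] seen so far:
  -- (g_π)_{π(i)} = f(π[i]) - f(π[i-1]).
  gAux : ∀ {n} → (Subset n → R) → Subset n → List (Fin n) → Fin n → R
  gAux f acc []       p = 0#
  gAux f acc (q ∷ qs) p =
    if does (p ≟ᶠ q) then f (acc ∪ ⁅ q ⁆) - f acc
                     else gAux f (acc ∪ ⁅ q ⁆) qs p

  g : ∀ {n} → (Subset n → R) → List (Fin n) → Fin n → R
  g f π = gAux f ⊥ π

  Submodular : ∀ {n} → (Subset n → R) → Set
  Submodular f = ∀ S T → f (S ∪ T) + f (S ∩ T) ≤ f S + f T

  -- contracted function f_P(S) = f(S ∪ P) - f(P)  (on subsets of V \ P)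
  contract : ∀ {n} → (Subset n → R) → Subset n → Subset n → R
  contract f P S = f (S ∪ P) - f P

  -- Functions/vectors on a ground set U ⊆ V are represented by functions on
  -- Subset n / Fin n of which only the values on subsets of U / points of U
  -- are used.

  InBase : ∀ {n} → Subset n → (Subset n → R) → (Fin n → R) → Set
  InBase U h y = (∀ S → S ⊆ U → vsum y S ≤ h S) × (vsum y U ≡ h U)

  -- h* = min_{S ⊆ U} h(S)   (∅ ⊆ U, so seeding the fold with h ∅ is harmless)
  minVal : ∀ {n} → Subset n → (Subset n → R) → R
  minVal U h = foldr (λ S r → h S ⊓ r) (h ⊥) (subsetsOf U)

  negSum : ∀ {n} → Subset n → (Fin n → R) → ℕ → R
  negSum U y ℓ = sumL (take ℓ (sort (map (λ p → y p ⊓ 0#) (elems U))))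
    where open Data.List.Sort decTotalOrder using (sort)

  DualCert : ∀ {n} → Subset n → (Subset n → R) → R → ℕ → (Fin n → R) → Set
  DualCert U h δ k y =
    (minVal U h ≤ negSum U y (suc k) + δ) ×
    (∀ S → S ⊆ U → ∣ S ∣ ℕ.≤ k → vsum y S ≤ h S)

  SparseMin : ∀ {n} → ℕ → (Subset n → R) → Subset n → Set
  SparseMin k f S = (∣ S ∣ ℕ.≤ k) × (∀ T → f S ≤ f T)

-- For a list qs and a set S disjoint from acc whose elements all occur in qs, the coordinates of the
-- greedy vector gAux acc qs summed over S telescope along qs to at most f(acc ∪ S) − f(acc): each marginal
-- is taken over a prefix containing acc plus the earlier elements of S, and submodularity lets us drop
-- the other elements of the prefix. Equality holds when every element of qs lies in acc ∪ S. Outside P,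
-- g of π with P moved to the front is the greedy vector started from acc = P, hence lies in B(f_P), and
-- so does the convex combination y←P. Since moving P forward only enlarges prefixes, y←P ≤ y outside P.
--
-- For the certificate, let T = S* ∖ P. As |T| ≤ k, y^{k+1}_-(V) ≤ y(T), so
--   y(P) + y^{k+1}_-(V) ≤ y(S*) ≤ f(S*) = f* ≤ y^{k+1}_-(V) + δ,  i.e.  y(P) ≤ δ.
-- The loss y − y←P is nonnegative on V ∖ P and sums to f(P) − y(P) there, so
-- y^{k+1}_-(V) ≤ (y←P)^{k+1}_-(V ∖ P) + f(P) − y(P); with f_P* ≤ f_P(T) = f(S*) − f(P) this gives the
-- (δ − y(P), k) certificate.

module Submission where

open import Defs
open import Algebra.Bundles using (CommutativeRing)
open import Algebra.Construct.NaturalChoice.Base using (MinOperator)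
import Algebra.Properties.CommutativeSemigroup as CommutativeSemigroupProperties
open import Data.Bool.Base using (true; false)
open import Data.Nat.Base as ℕ using (ℕ; zero; suc; s≤s; z≤n)
import Data.Nat.Properties as ℕₚ
open import Data.Fin.Base using (Fin; zero; suc)
open import Data.Fin.Subset using (Subset; _∈_; _∉_; _⊆_; _∪_; _∩_; ∁; ⁅_⁆; ⊥; ⊤; ∣_∣; inside; outside)
open import Data.Fin.Subset.Properties
  using ( _∈?_; _⊆?_; ∈⊤; x∈⁅x⁆; x∈⁅y⁆⇒x≡y; x∉⁅y⁆⇒x≢y; x∈∁p⇒x∉p; x∉p⇒x∈∁p; x∈p∩q⁺; x∈p∩q⁻; x∈p∪q⁺; x∈p∪q⁻
        ; p⊆p∪q; q⊆p∪q; p∩q⊆p; p∩q⊆q; ⊆-antisym; ⊆-min; Empty-unique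
        ; ⊆⊤; ∣p∩q∣≤∣p∣
        ; ∪-assoc; ∪-comm; ∪-identityˡ; ∪-identityʳ; ∪-inverseˡ; ∪-inverseʳ; ∪-distribˡ-∩; ∩-comm; ∩-identityˡ; ∩-identityʳ; ∩-distribʳ-∪)
open import Data.List.Base using (List; []; _∷_; _++_; map; filter; foldr; take; length; tabulate; allFin)
open import Data.List.Properties using (map-cong; map-cong-local; map-∘; map-tabulate; length-map; take-all)
open import Data.List.Relation.Unary.All.Properties using (all-filter) renaming (map⁺ to All-map⁺)
open import Data.List.Membership.Propositional using () renaming (_∈_ to _∈ˡ_)
open import Data.List.Membership.Propositional.Properties using (∈-filter⁺; ∈-map⁺; ∈-++⁺ˡ; ∈-++⁺ʳ; ∈-allFin)
open import Data.List.Relation.Unary.Any as Any using (here; there)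
open import Data.List.Relation.Unary.Any.Properties using (¬Any[])
open import Data.Fin.Properties using (_≟_)
open import Data.List.Relation.Binary.Sublist.Propositional using (⊆-refl)
open import Data.List.Relation.Binary.Sublist.Propositional.Properties using (filter⁺) renaming (map⁺ to ⊑-map⁺)
open import Data.List.Relation.Unary.All as All using (All; []; _∷_)
open import Data.List.Relation.Unary.Linked using (Linked; []; [-]; _∷_)
open import Data.List.Relation.Unary.Linked.Properties using (Linked⇒All)
open import Data.List.Relation.Binary.Sublist.Propositional using ([]; _∷_; _∷ʳ_) renaming (_⊆_ to _⊑_)
open import Data.List.Relation.Binary.Permutation.Propositional using (_↭_; refl; prep; swap; ↭-sym) renaming (trans to ↭-trans)
open import Data.List.Relation.Binary.Permutation.Propositional.Properties using (All-resp-↭; ∈-resp-↭)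
import Data.List.Sort
open import Data.Product using (_×_; _,_; proj₁; proj₂)
open import Data.Sum using (_⊎_; inj₁; inj₂; [_,_]′)
open import Data.Vec.Base using ([]; _∷_)
open import Function.Base using (id; _∘_)
open import Relation.Binary.Bundles using (DecTotalOrder)
open import Relation.Binary.PropositionalEquality
  using (_≡_; _≢_; refl; sym; trans; cong; cong₂; subst; subst₂; module ≡-Reasoning)
import Relation.Binary.Reasoning.PartialOrder
open import Relation.Nullary using (does; yes; no; ¬?; contradiction)

module OrderedFieldProperties (F : OrderedField) where
  open OrderedField F public renaming (+-mono-≤ to +-monoˡ-≤)
  open DecTotalOrder decTotalOrder public
    using (antisym; poset; totalPreorder)
    renaming (refl to ≤-refl; trans to ≤-trans; reflexive to ≤-reflexive)

  commutativeRing : CommutativeRing _ _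
  commutativeRing = record { isCommutativeRing = isCommutativeRing }

  open CommutativeRing commutativeRing public
    using ( +-assoc; +-comm; +-identityˡ; +-identityʳ; -‿inverseʳ; *-comm; *-identityʳ
          ; zeroʳ; distribˡ; +-abelianGroup; +-commutativeMonoid; ring)
  open import Algebra.Properties.AbelianGroup +-abelianGroup public
    using (//-rightDividesˡ; //-rightDividesʳ; ⁻¹-anti-homo‿-; ⁻¹-∙-comm; ε⁻¹≈ε)
  open import Algebra.Properties.Ring ring public using (x[y-z]≈xy-xz)
  open import Algebra.Solver.CommutativeMonoid +-commutativeMonoid public
    using (solve; _⊕_; _⊜_)
  open CommutativeSemigroupProperties (CommutativeRing.+-commutativeSemigroup commutativeRing) public
    using () renaming (interchange to +-interchange; x∙yz≈y∙xz to +-leftComm)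

  module ≤-Reasoning = Relation.Binary.Reasoning.PartialOrder poset

  x+[y-y]≡x : ∀ x y → x + (y - y) ≡ x
  x+[y-y]≡x x y = trans (cong (x +_) (-‿inverseʳ y)) (+-identityʳ x)

  [x-y]+[y-z]≡x-z : ∀ x y z → (x - y) + (y - z) ≡ x - z
  [x-y]+[y-z]≡x-z x y z = trans
    (solve 4 (λ x y -y -z → ((x ⊕ -y) ⊕ (y ⊕ -z)) ⊜ ((x ⊕ -z) ⊕ (y ⊕ -y))) refl x y (- y) (- z))
    (x+[y-y]≡x (x - z) y)

  [x-y]-[x-z]≡z-y : ∀ x y z → (x - y) - (x - z) ≡ z - y
  [x-y]-[x-z]≡z-y x y z = begin
    (x - y) - (x - z)          ≡⟨ cong ((x - y) +_) (⁻¹-anti-homo‿- x z) ⟩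
    (x + - y) + (z + - x)      ≡⟨ solve 4 (λ x -x -y z → ((x ⊕ -y) ⊕ (z ⊕ -x)) ⊜ ((z ⊕ -y) ⊕ (x ⊕ -x))) refl x (- x) (- y) z ⟩
    (z - y) + (x - x)          ≡⟨ x+[y-y]≡x (z - y) x ⟩
    z - y                      ∎
    where open ≡-Reasoning

  [x+[y-z]+w]-y≡x+[w-z] : ∀ x y z w → ((x + (y - z)) + w) - y ≡ x + (w - z)
  [x+[y-z]+w]-y≡x+[w-z] x y z w = trans
    (solve 5 (λ x y -y -z w → (((x ⊕ (y ⊕ -z)) ⊕ w) ⊕ -y) ⊜ ((x ⊕ (w ⊕ -z)) ⊕ (y ⊕ -y))) refl x y (- y) (- z) w)
    (x+[y-y]≡x (x + (w - z)) y)

  +-monoʳ-≤ : ∀ {x y} z → x ≤ y → z + x ≤ z + y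
  +-monoʳ-≤ {x} {y} z x≤y = subst₂ _≤_ (+-comm x z) (+-comm y z) (+-monoˡ-≤ z x≤y)

  +-mono-≤ : ∀ {x y u v} → x ≤ y → u ≤ v → x + u ≤ y + v
  +-mono-≤ {y = y} {u} x≤y u≤v = ≤-trans (+-monoˡ-≤ u x≤y) (+-monoʳ-≤ y u≤v)

  +-cancelʳ-≤ : ∀ {x y} z → x + z ≤ y + z → x ≤ y
  +-cancelʳ-≤ {x} {y} z le = subst₂ _≤_ (//-rightDividesʳ z x) (//-rightDividesʳ z y) (+-monoˡ-≤ (- z) le)

  x≤y⇒0≤y-x : ∀ {x y} → x ≤ y → 0# ≤ y - x
  x≤y⇒0≤y-x {x} {y} le = subst (_≤ y - x) (-‿inverseʳ x) (+-monoˡ-≤ (- x) le)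

  0≤y-x⇒x≤y : ∀ {x y} → 0# ≤ y - x → x ≤ y
  0≤y-x⇒x≤y {x} {y} le = subst₂ _≤_ (+-identityˡ x) (//-rightDividesˡ x y) (+-monoˡ-≤ x le)

  x+w≤z+y⇒x-y≤z-w : ∀ {x y z w} → x + w ≤ z + y → x - y ≤ z - w
  x+w≤z+y⇒x-y≤z-w {x} {y} {z} {w} le =
    subst₂ _≤_ (shuffle x w y) (trans (cong (z + y +_) (+-comm (- y) (- w))) (shuffle z y w)) (+-monoˡ-≤ (- y + - w) le)
    where
      shuffle : ∀ a b c → (a + b) + (- c + - b) ≡ a - c
      shuffle a b c = trans
        (solve 4 (λ a b -b -c → ((a ⊕ b) ⊕ (-c ⊕ -b)) ⊜ ((a ⊕ -c) ⊕ (b ⊕ -b))) refl a b (- b) (- c))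
        (x+[y-y]≡x (a - c) b)

  *-monoʳ-≤-nonneg : ∀ {x y} c → 0# ≤ c → x ≤ y → c * x ≤ c * y
  *-monoʳ-≤-nonneg {x} {y} c 0≤c x≤y =
    0≤y-x⇒x≤y (subst (0# ≤_) (x[y-z]≈xy-xz c y x) (*-nonneg 0≤c (x≤y⇒0≤y-x x≤y)))

  x≤y⇒x⊓y≡x : ∀ {x y} → x ≤ y → x ⊓ y ≡ x
  x≤y⇒x⊓y≡x {x} {y} x≤y with x ≤? y
  ... | yes _   = refl
  ... | no x≰y = contradiction x≤y x≰y

  minOperator : MinOperator totalPreorder
  minOperator = record { _⊓_ = _⊓_ ; x≤y⇒x⊓y≈x = x≤y⇒x⊓y≡x ; x≥y⇒x⊓y≈y = y≤x⇒x⊓y≡y }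
    where
      y≤x⇒x⊓y≡y : ∀ {x y} → y ≤ x → x ⊓ y ≡ y
      y≤x⇒x⊓y≡y {x} {y} y≤x with x ≤? y
      ... | yes x≤y = antisym x≤y y≤x
      ... | no _    = refl

  open import Algebra.Construct.NaturalChoice.MinOp minOperator public
    using (x⊓y≤x; x⊓y≤y; ⊓-glb; ⊓-mono-≤; ⊓-commutativeSemigroup)
  open import Algebra.Construct.NaturalChoice.MinOp minOperator using (mono-≤-distrib-⊓)
  open CommutativeSemigroupProperties ⊓-commutativeSemigroup public
    using () renaming (interchange to ⊓-interchange; x∙yz≈y∙xz to ⊓-leftComm)

  +-distribˡ-⊓ : ∀ x y z → x + (y ⊓ z) ≡ (x + y) ⊓ (x + z)
  +-distribˡ-⊓ x = mono-≤-distrib-⊓ (cong (x +_)) (+-monoʳ-≤ x)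

  +-distribʳ-⊓ : ∀ z x y → (x ⊓ y) + z ≡ (x + z) ⊓ (y + z)
  +-distribʳ-⊓ z = mono-≤-distrib-⊓ (cong (_+ z)) (+-monoˡ-≤ z)

  y≤x⇒x⊓0≤[y⊓0]+[x-y] : ∀ {x y} → y ≤ x → x ⊓ 0# ≤ (y ⊓ 0#) + (x - y)
  y≤x⇒x⊓0≤[y⊓0]+[x-y] {x} {y} y≤x = begin
    x ⊓ 0#                          ≤⟨ ⊓-mono-≤ ≤-refl (x≤y⇒0≤y-x y≤x) ⟩
    x ⊓ (x - y)                     ≡⟨ cong₂ _⊓_ (trans (+-comm y (x - y)) (//-rightDividesˡ y x)) (+-identityˡ (x - y)) ⟨
    (y + (x - y)) ⊓ (0# + (x - y))  ≡⟨ +-distribʳ-⊓ (x - y) y 0# ⟨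
    (y ⊓ 0#) + (x - y)              ∎
    where open ≤-Reasoning

module ListSums (F : OrderedField) where
  open OrderedFieldProperties F

  module _ {A : Set} where

    sum-map-cong : ∀ {h k : A → R} xs → (∀ x → h x ≡ k x) → sumL (map h xs) ≡ sumL (map k xs)
    sum-map-cong xs h≗k = cong sumL (map-cong h≗k xs)

    sum-map-0 : ∀ (xs : List A) → sumL (map (λ _ → 0#) xs) ≡ 0#
    sum-map-0 []       = refl
    sum-map-0 (x ∷ xs) = trans (+-identityˡ _) (sum-map-0 xs)

    sum-map-+ : ∀ (h k : A → R) xs → sumL (map (λ x → h x + k x) xs) ≡ sumL (map h xs) + sumL (map k xs)
    sum-map-+ h k []       = sym (+-identityˡ 0#)
    sum-map-+ h k (x ∷ xs) = trans (cong (h x + k x +_) (sum-map-+ h k xs)) (+-interchange _ _ _ _)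

    sum-map-neg : ∀ (h : A → R) xs → sumL (map (λ x → - h x) xs) ≡ - sumL (map h xs)
    sum-map-neg h []       = sym ε⁻¹≈ε
    sum-map-neg h (x ∷ xs) = trans (cong (- h x +_) (sum-map-neg h xs)) (⁻¹-∙-comm _ _)

    sum-map-*ˡ : ∀ c (h : A → R) xs → sumL (map (λ x → c * h x) xs) ≡ c * sumL (map h xs)
    sum-map-*ˡ c h []       = sym (zeroʳ c)
    sum-map-*ˡ c h (x ∷ xs) = trans (cong (c * h x +_) (sum-map-*ˡ c h xs)) (sym (distribˡ c _ _))

    sum-map-mono : ∀ {h k : A → R} {xs} → All (λ x → h x ≤ k x) xs → sumL (map h xs) ≤ sumL (map k xs)
    sum-map-mono []           = ≤-refl
    sum-map-mono (h≤k ∷ h≤ks) = +-mono-≤ h≤k (sum-map-mono h≤ks)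

    sum-map-nonneg : ∀ {h : A → R} {xs} → All (λ x → 0# ≤ h x) xs → 0# ≤ sumL (map h xs)
    sum-map-nonneg {h} {xs} 0≤h = subst (_≤ sumL (map h xs)) (sum-map-0 xs) (sum-map-mono 0≤h)

  sum-map-swap : ∀ {A B : Set} (h : A → B → R) xs ys →
    sumL (map (λ x → sumL (map (h x) ys)) xs) ≡ sumL (map (λ y → sumL (map (λ x → h x y) xs)) ys)
  sum-map-swap h []       ys = sym (sum-map-0 ys)
  sum-map-swap h (x ∷ xs) ys = trans (cong (sumL (map (h x) ys) +_) (sum-map-swap h xs ys))
                                     (sym (sum-map-+ (h x) _ ys))

  convex-≤ : ∀ {m} (α v : Fin m → R) {c} → (∀ t → 0# ≤ α t) → fsum F α ≡ 1# → (∀ t → v t ≤ c) →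
             fsum F (λ t → α t * v t) ≤ c
  convex-≤ {m} α v {c} 0≤α Σα≡1 v≤c = subst (_ ≤_) c*Σα≡c
    (sum-map-mono (All.universal (λ t → subst (α t * v t ≤_) (*-comm (α t) c)
                                         (*-monoʳ-≤-nonneg (α t) (0≤α t) (v≤c t))) (allFin m)))
    where
      c*Σα≡c : sumL (map (λ t → c * α t) (allFin m)) ≡ c
      c*Σα≡c = trans (sum-map-*ˡ c α (allFin m)) (trans (cong (c *_) Σα≡1) (*-identityʳ c))

  convex-≡ : ∀ {m} (α v : Fin m → R) {c} → fsum F α ≡ 1# → (∀ t → v t ≡ c) → fsum F (λ t → α t * v t) ≡ c
  convex-≡ {m} α v {c} Σα≡1 v≡c = begin
    sumL (map (λ t → α t * v t) (allFin m)) ≡⟨ sum-map-cong (allFin m) (λ t → trans (cong (α t *_) (v≡c t)) (*-comm (α t) c)) ⟩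
    sumL (map (λ t → c * α t) (allFin m))   ≡⟨ sum-map-*ˡ c α (allFin m) ⟩
    c * fsum F α                            ≡⟨ cong (c *_) Σα≡1 ⟩
    c * 1#                                  ≡⟨ *-identityʳ c ⟩
    c                                       ∎
    where open ≡-Reasoning

module MinSum (F : OrderedField) where
  open OrderedFieldProperties F
  open ListSums F
  open Data.List.Sort decTotalOrder using (sort; sort-↭; sort-↗)

  -- minSum ℓ xs is the least sum of a sub-multiset of xs with at most ℓ elements (0 for the empty one).
  minSum : ℕ → List R → R
  minSum zero    _        = 0#
  minSum (suc ℓ) []       = 0#
  minSum (suc ℓ) (x ∷ xs) = (x + minSum ℓ xs) ⊓ minSum (suc ℓ) xs

  minSum-[] : ∀ ℓ → minSum ℓ [] ≡ 0#
  minSum-[] zero    = refl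
  minSum-[] (suc ℓ) = refl

  minSum-∷-≤ : ∀ ℓ x xs → minSum ℓ (x ∷ xs) ≤ minSum ℓ xs
  minSum-∷-≤ zero    x xs = ≤-refl
  minSum-∷-≤ (suc ℓ) x xs = x⊓y≤y _ _

  minSum-swap : ∀ ℓ x y zs → minSum ℓ (x ∷ y ∷ zs) ≡ minSum ℓ (y ∷ x ∷ zs)
  minSum-swap zero          x y zs = refl
  minSum-swap (suc zero)    x y zs = ⊓-leftComm _ _ _
  minSum-swap (suc (suc ℓ)) x y zs = begin
    (x + ((y + m ℓ) ⊓ m₁)) ⊓ ((y + m₁) ⊓ m₂)           ≡⟨ cong (_⊓ ((y + m₁) ⊓ m₂)) (+-distribˡ-⊓ x _ _) ⟩
    ((x + (y + m ℓ)) ⊓ (x + m₁)) ⊓ ((y + m₁) ⊓ m₂)     ≡⟨ cong (λ z → (z ⊓ (x + m₁)) ⊓ ((y + m₁) ⊓ m₂)) (+-leftComm x y (m ℓ)) ⟩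
    ((y + (x + m ℓ)) ⊓ (x + m₁)) ⊓ ((y + m₁) ⊓ m₂)     ≡⟨ ⊓-interchange _ _ _ _ ⟩
    ((y + (x + m ℓ)) ⊓ (y + m₁)) ⊓ ((x + m₁) ⊓ m₂)     ≡⟨ cong (_⊓ ((x + m₁) ⊓ m₂)) (+-distribˡ-⊓ y _ _) ⟨
    (y + ((x + m ℓ) ⊓ m₁)) ⊓ ((x + m₁) ⊓ m₂)           ∎
    where
      open ≡-Reasoning
      m : ℕ → R
      m ℓ = minSum ℓ zs
      m₁ = m (suc ℓ)
      m₂ = m (suc (suc ℓ))

  minSum-∷-cong : ∀ x {xs ys} → (∀ ℓ → minSum ℓ xs ≡ minSum ℓ ys) → ∀ ℓ → minSum ℓ (x ∷ xs) ≡ minSum ℓ (x ∷ ys)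
  minSum-∷-cong x eq zero    = refl
  minSum-∷-cong x eq (suc ℓ) = cong₂ (λ u v → (x + u) ⊓ v) (eq ℓ) (eq (suc ℓ))

  minSum-↭ : ∀ {xs ys} → xs ↭ ys → ∀ ℓ → minSum ℓ xs ≡ minSum ℓ ys
  minSum-↭ refl                  ℓ = refl
  minSum-↭ (prep x xs↭ys)        ℓ = minSum-∷-cong x (minSum-↭ xs↭ys) ℓ
  minSum-↭ (swap x y xs↭ys)      ℓ = trans (minSum-swap ℓ x y _) (minSum-∷-cong y (minSum-∷-cong x (minSum-↭ xs↭ys)) ℓ)
  minSum-↭ (↭-trans xs↭ys ys↭zs) ℓ = trans (minSum-↭ xs↭ys ℓ) (minSum-↭ ys↭zs ℓ)

  minSum-antitone : ∀ {xs ys} → ys ⊑ xs → ∀ ℓ → minSum ℓ xs ≤ minSum ℓ ys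
  minSum-antitone []              ℓ       = ≤-refl
  minSum-antitone (x ∷ʳ ys⊑xs)    ℓ       = ≤-trans (minSum-∷-≤ ℓ x _) (minSum-antitone ys⊑xs ℓ)
  minSum-antitone (refl ∷ ys⊑xs)  zero    = ≤-refl
  minSum-antitone (refl ∷ ys⊑xs)  (suc ℓ) =
    ⊓-mono-≤ (+-monoʳ-≤ _ (minSum-antitone ys⊑xs ℓ)) (minSum-antitone ys⊑xs (suc ℓ))

  minSum≤sum : ∀ ℓ xs → length xs ℕ.≤ ℓ → minSum ℓ xs ≤ sumL xs
  minSum≤sum ℓ       []       _            = ≤-reflexive (minSum-[] ℓ)
  minSum≤sum (suc ℓ) (x ∷ xs) (s≤s |xs|≤ℓ) = ≤-trans (x⊓y≤x _ _) (+-monoʳ-≤ x (minSum≤sum ℓ xs |xs|≤ℓ))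

  minSum-perturb : ∀ {A : Set} (c b e : A → R) {xs} →
    All (λ x → c x ≤ b x + e x) xs → All (λ x → 0# ≤ e x) xs →
    ∀ ℓ → minSum ℓ (map c xs) ≤ minSum ℓ (map b xs) + sumL (map e xs)
  minSum-perturb c b e []               []         ℓ = ≤-reflexive (sym (+-identityʳ _))
  minSum-perturb c b e {x ∷ xs} _ 0≤es zero = subst (0# ≤_) (sym (+-identityˡ _)) (sum-map-nonneg 0≤es)
  minSum-perturb c b e {x ∷ xs} (c≤b+e ∷ c≤b+es) (0≤e ∷ 0≤es) (suc ℓ) = begin
    (c x + minSum ℓ (map c xs)) ⊓ minSum (suc ℓ) (map c xs)
      ≤⟨ ⊓-mono-≤ (+-mono-≤ c≤b+e (minSum-perturb c b e c≤b+es 0≤es ℓ)) (minSum-perturb c b e c≤b+es 0≤es (suc ℓ)) ⟩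
    ((b x + e x) + (minSum ℓ (map b xs) + E)) ⊓ (minSum (suc ℓ) (map b xs) + E)
      ≤⟨ ⊓-mono-≤ (≤-reflexive (+-interchange (b x) (e x) _ E)) (+-monoʳ-≤ _ E≤e+E) ⟩
    ((b x + minSum ℓ (map b xs)) + (e x + E)) ⊓ (minSum (suc ℓ) (map b xs) + (e x + E))
      ≡⟨ +-distribʳ-⊓ (e x + E) _ _ ⟨
    ((b x + minSum ℓ (map b xs)) ⊓ minSum (suc ℓ) (map b xs)) + (e x + E) ∎
    where
      open ≤-Reasoning
      E = sumL (map e xs)
      E≤e+E : E ≤ e x + E
      E≤e+E = subst (_≤ e x + E) (+-identityˡ E) (+-monoˡ-≤ E 0≤e)

  private
    Linked-tail : ∀ {x xs} → Linked _≤_ (x ∷ xs) → Linked _≤_ xs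
    Linked-tail [-]           = []
    Linked-tail (_ ∷ sorted) = sorted

    take-[] : ∀ ℓ → take ℓ ([] {A = R}) ≡ []
    take-[] ℓ = take-all ℓ [] z≤n

  x+sum-take≤sum-take-suc : ∀ {x} ℓ xs → x ≤ 0# → All (x ≤_) xs → x + sumL (take ℓ xs) ≤ sumL (take (suc ℓ) xs)
  x+sum-take≤sum-take-suc {x} ℓ       []       x≤0 []           =
    subst (λ ys → x + sumL ys ≤ 0#) (sym (take-[] ℓ)) (subst (_≤ 0#) (sym (+-identityʳ x)) x≤0)
  x+sum-take≤sum-take-suc     zero    (w ∷ ws) _   (x≤w ∷ _)    = +-monoˡ-≤ 0# x≤w
  x+sum-take≤sum-take-suc {x} (suc ℓ) (w ∷ ws) x≤0 (_ ∷ x≤ws) =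
    subst (_≤ w + sumL (take (suc ℓ) ws)) (+-leftComm w x _) (+-monoʳ-≤ w (x+sum-take≤sum-take-suc ℓ ws x≤0 x≤ws))

  minSum-sorted : ∀ {xs} → Linked _≤_ xs → All (_≤ 0#) xs → ∀ ℓ → minSum ℓ xs ≡ sumL (take ℓ xs)
  minSum-sorted {[]}     _      _            ℓ       = trans (minSum-[] ℓ) (cong sumL (sym (take-[] ℓ)))
  minSum-sorted {x ∷ xs} _      _            zero    = refl
  minSum-sorted {x ∷ xs} sorted (x≤0 ∷ xs≤0) (suc ℓ) = begin
    (x + minSum ℓ xs) ⊓ minSum (suc ℓ) xs                   ≡⟨ cong₂ (λ u v → (x + u) ⊓ v) (minSum-sorted tail xs≤0 ℓ)
                                                                                          (minSum-sorted tail xs≤0 (suc ℓ)) ⟩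
    (x + sumL (take ℓ xs)) ⊓ sumL (take (suc ℓ) xs)         ≡⟨ x≤y⇒x⊓y≡x (x+sum-take≤sum-take-suc ℓ xs x≤0 x≤xs) ⟩
    x + sumL (take ℓ xs)                                    ∎
    where
      open ≡-Reasoning
      tail = Linked-tail sorted
      x≤xs = All.tail (Linked⇒All ≤-trans ≤-refl sorted)

  sum-take-sort≡minSum : ∀ xs → All (_≤ 0#) xs → ∀ ℓ → sumL (take ℓ (sort xs)) ≡ minSum ℓ xs
  sum-take-sort≡minSum xs xs≤0 ℓ = trans
    (sym (minSum-sorted (sort-↗ xs) (All-resp-↭ (↭-sym (sort-↭ xs)) xs≤0) ℓ))
    (minSum-↭ (sort-↭ xs) ℓ)

module SubsetProperties where
  private variable n : ℕ

  p⊆q⇒p∪q≡q : {p q : Subset n} → p ⊆ q → p ∪ q ≡ q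
  p⊆q⇒p∪q≡q {p = p} {q} p⊆q = ⊆-antisym (λ x∈p∪q → [ p⊆q , id ]′ (x∈p∪q⁻ p q x∈p∪q)) (q⊆p∪q p q)

  p⊆q⇒p∩q≡p : {p q : Subset n} → p ⊆ q → p ∩ q ≡ p
  p⊆q⇒p∩q≡p {p = p} {q} p⊆q = ⊆-antisym (p∩q⊆p p q) (λ x∈p → x∈p∩q⁺ (x∈p , p⊆q x∈p))

  p⊆q⇒p∪[q∩∁p]≡q : {p q : Subset n} → p ⊆ q → p ∪ (q ∩ ∁ p) ≡ q
  p⊆q⇒p∪[q∩∁p]≡q {p = p} {q} p⊆q = begin
    p ∪ (q ∩ ∁ p)         ≡⟨ ∪-distribˡ-∩ p q (∁ p) ⟩
    (p ∪ q) ∩ (p ∪ ∁ p)   ≡⟨ cong ((p ∪ q) ∩_) (∪-inverseʳ p) ⟩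
    (p ∪ q) ∩ ⊤           ≡⟨ ∩-identityʳ (p ∪ q) ⟩
    p ∪ q                 ≡⟨ p⊆q⇒p∪q≡q p⊆q ⟩
    q                     ∎
    where open ≡-Reasoning

  q∈p⇒⁅q⁆⊆p : {p : Subset n} {q : Fin n} → q ∈ p → ⁅ q ⁆ ⊆ p
  q∈p⇒⁅q⁆⊆p {p = p} {q} q∈p x∈⁅q⁆ = subst (_∈ p) (sym (x∈⁅y⁆⇒x≡y q x∈⁅q⁆)) q∈p

  x∉p⇒x≢q⇒x∈∁[p∪⁅q⁆] : {p : Subset n} {x q : Fin n} → x ∉ p → x ≢ q → x ∈ ∁ (p ∪ ⁅ q ⁆)
  x∉p⇒x≢q⇒x∈∁[p∪⁅q⁆] {p = p} {q = q} x∉p x≢q =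
    x∉p⇒x∈∁p λ x∈p∪⁅q⁆ → [ x∉p , (λ x∈⁅q⁆ → x≢q (x∈⁅y⁆⇒x≡y q x∈⁅q⁆)) ]′ (x∈p∪q⁻ p ⁅ q ⁆ x∈p∪⁅q⁆)

  [p∪⁅q⁆]∪[r∩∁⁅q⁆]≡p∪r : {p r : Subset n} {q : Fin n} → q ∈ r → (p ∪ ⁅ q ⁆) ∪ (r ∩ ∁ ⁅ q ⁆) ≡ p ∪ r
  [p∪⁅q⁆]∪[r∩∁⁅q⁆]≡p∪r {p = p} {r} {q} q∈r = trans (∪-assoc p ⁅ q ⁆ _) (cong (p ∪_) (p⊆q⇒p∪[q∩∁p]≡q (q∈p⇒⁅q⁆⊆p q∈r)))

  private
    filter-∈?-map-suc : ∀ s (p : Subset n) xs → filter (_∈? (s ∷ p)) (map suc xs) ≡ map suc (filter (_∈? p) xs)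
    filter-∈?-map-suc s p []       = refl
    filter-∈?-map-suc s p (x ∷ xs) with does (x ∈? p)
    ... | true  = cong (suc x ∷_) (filter-∈?-map-suc s p xs)
    ... | false = filter-∈?-map-suc s p xs

    elems-∷ : ∀ s (p : Subset n) → filter (_∈? (s ∷ p)) (tabulate suc) ≡ map suc (elems p)
    elems-∷ {n} s p = trans (cong (filter (_∈? (s ∷ p))) (sym (map-tabulate id suc))) (filter-∈?-map-suc s p (allFin n))

  elems-inside : (p : Subset n) → elems (inside ∷ p) ≡ zero ∷ map suc (elems p)
  elems-inside p = cong (zero ∷_) (elems-∷ inside p)

  elems-outside : (p : Subset n) → elems (outside ∷ p) ≡ map suc (elems p)
  elems-outside p = elems-∷ outside p

  length-elems : (p : Subset n) → length (elems p) ≡ ∣ p ∣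
  length-elems []            = refl
  length-elems (inside ∷ p)  =
    trans (cong length (elems-inside p)) (cong suc (trans (length-map suc (elems p)) (length-elems p)))
  length-elems (outside ∷ p) =
    trans (cong length (elems-outside p)) (trans (length-map suc (elems p)) (length-elems p))

  elems-⊆ : {p q : Subset n} → p ⊆ q → elems p ⊑ elems q
  elems-⊆ {n} {p} {q} p⊆q = filter⁺ (_∈? p) (_∈? q) (λ { refl → p⊆q }) (⊆-refl {x = allFin n})

  All-elems : {p : Subset n} → All (_∈ p) (elems p)
  All-elems {n} {p} = all-filter (_∈? p) (allFin n)

module SubsetSums (F : OrderedField) where
  open OrderedFieldProperties F
  open ListSums F
  open SubsetProperties
  private variable n : ℕ

  vsum-inside : ∀ (y : Fin (suc n) → R) p → vsum F y (inside ∷ p) ≡ y zero + vsum F (y ∘ suc) p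
  vsum-inside y p = trans (cong (sumL ∘ map y) (elems-inside p)) (cong (y zero +_) (cong sumL (sym (map-∘ (elems p)))))

  vsum-outside : ∀ (y : Fin (suc n) → R) p → vsum F y (outside ∷ p) ≡ vsum F (y ∘ suc) p
  vsum-outside y p = trans (cong (sumL ∘ map y) (elems-outside p)) (cong sumL (sym (map-∘ (elems p))))

  vsum-⊥ : ∀ (y : Fin n → R) → vsum F y ⊥ ≡ 0#
  vsum-⊥ {zero}  y = refl
  vsum-⊥ {suc n} y = trans (vsum-outside y ⊥) (vsum-⊥ (y ∘ suc))

  vsum-⁅⁆ : ∀ (y : Fin n → R) q → vsum F y ⁅ q ⁆ ≡ y q
  vsum-⁅⁆ y zero    = trans (vsum-inside y ⊥) (trans (cong (y zero +_) (vsum-⊥ (y ∘ suc))) (+-identityʳ (y zero)))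
  vsum-⁅⁆ y (suc q) = trans (vsum-outside y ⁅ q ⁆) (vsum-⁅⁆ (y ∘ suc) q)

  vsum-split : ∀ (y : Fin n → R) p q → vsum F y p ≡ vsum F y (p ∩ q) + vsum F y (p ∩ ∁ q)
  vsum-split y []            []            = sym (+-identityʳ 0#)
  vsum-split y (inside ∷ p)  (inside ∷ q)  = begin
    vsum F y (inside ∷ p)                      ≡⟨ vsum-inside y p ⟩
    y zero + vsum F y′ p                       ≡⟨ cong (y zero +_) (vsum-split y′ p q) ⟩
    y zero + (vsum F y′ (p ∩ q) + vsum F y′ (p ∩ ∁ q))  ≡⟨ +-assoc _ _ _ ⟨
    (y zero + vsum F y′ (p ∩ q)) + vsum F y′ (p ∩ ∁ q)  ≡⟨ cong₂ _+_ (vsum-inside y (p ∩ q)) (vsum-outside y (p ∩ ∁ q)) ⟨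
    vsum F y (inside ∷ p ∩ q) + vsum F y (outside ∷ p ∩ ∁ q)  ∎
    where
      open ≡-Reasoning
      y′ = y ∘ suc
  vsum-split y (inside ∷ p)  (outside ∷ q) = begin
    vsum F y (inside ∷ p)                      ≡⟨ vsum-inside y p ⟩
    y zero + vsum F y′ p                       ≡⟨ cong (y zero +_) (vsum-split y′ p q) ⟩
    y zero + (vsum F y′ (p ∩ q) + vsum F y′ (p ∩ ∁ q))  ≡⟨ +-leftComm _ _ _ ⟩
    vsum F y′ (p ∩ q) + (y zero + vsum F y′ (p ∩ ∁ q))  ≡⟨ cong₂ _+_ (vsum-outside y (p ∩ q)) (vsum-inside y (p ∩ ∁ q)) ⟨
    vsum F y (outside ∷ p ∩ q) + vsum F y (inside ∷ p ∩ ∁ q)  ∎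
    where
      open ≡-Reasoning
      y′ = y ∘ suc
  vsum-split y (outside ∷ p) (s ∷ q)       = begin
    vsum F y (outside ∷ p)                     ≡⟨ vsum-outside y p ⟩
    vsum F y′ p                                ≡⟨ vsum-split y′ p q ⟩
    vsum F y′ (p ∩ q) + vsum F y′ (p ∩ ∁ q)    ≡⟨ cong₂ _+_ (vsum-outside y (p ∩ q)) (vsum-outside y (p ∩ ∁ q)) ⟨
    vsum F y (outside ∷ p ∩ q) + vsum F y (outside ∷ p ∩ ∁ q)  ∎
    where
      open ≡-Reasoning
      y′ = y ∘ suc

  vsum-cong : ∀ {y z : Fin n → R} p → (∀ {x} → x ∈ p → y x ≡ z x) → vsum F y p ≡ vsum F z p
  vsum-cong p y≡z = cong sumL (map-cong-local (All.map y≡z All-elems))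

  vsum-linear : ∀ {m} (α : Fin m → R) (h : Fin m → Fin n → R) p →
    vsum F (λ x → fsum F (λ t → α t * h t x)) p ≡ fsum F (λ t → α t * vsum F (h t) p)
  vsum-linear {m = m} α h p = trans (sum-map-swap (λ x t → α t * h t x) (elems p) (allFin m))
                                    (sum-map-cong (allFin m) (λ t → sum-map-*ˡ (α t) (h t) (elems p)))

  vsum-sub : ∀ (y z : Fin n → R) p → vsum F (λ x → y x - z x) p ≡ vsum F y p - vsum F z p
  vsum-sub y z p = trans (sum-map-+ y (λ x → - z x) (elems p)) (cong (vsum F y p +_) (sum-map-neg z (elems p)))

module Submodularity (F : OrderedField) {n : ℕ} (f : Subset n → OrderedField.R F) where
  open OrderedFieldProperties F
  open SubsetProperties

  diminishing-returns : Submodular F f → ∀ {A B Z} → A ⊆ B → Z ∩ B ⊆ A → f (B ∪ Z) - f B ≤ f (A ∪ Z) - f A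
  diminishing-returns sub {A} {B} {Z} A⊆B Z∩B⊆A =
    x+w≤z+y⇒x-y≤z-w (subst₂ (λ U V → f U + f V ≤ f (A ∪ Z) + f B) union intersection (sub (A ∪ Z) B))
    where
      open ≡-Reasoning
      union : (A ∪ Z) ∪ B ≡ B ∪ Z
      union = begin
        (A ∪ Z) ∪ B   ≡⟨ ∪-assoc A Z B ⟩
        A ∪ (Z ∪ B)   ≡⟨ cong (A ∪_) (∪-comm Z B) ⟩
        A ∪ (B ∪ Z)   ≡⟨ ∪-assoc A B Z ⟨
        (A ∪ B) ∪ Z   ≡⟨ cong (_∪ Z) (p⊆q⇒p∪q≡q A⊆B) ⟩
        B ∪ Z         ∎
      intersection : (A ∪ Z) ∩ B ≡ A
      intersection = begin
        (A ∪ Z) ∩ B         ≡⟨ ∩-distribʳ-∪ B A Z ⟩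
        (A ∩ B) ∪ (Z ∩ B)   ≡⟨ cong (_∪ (Z ∩ B)) (p⊆q⇒p∩q≡p A⊆B) ⟩
        A ∪ (Z ∩ B)         ≡⟨ ∪-comm A (Z ∩ B) ⟩
        (Z ∩ B) ∪ A         ≡⟨ p⊆q⇒p∪q≡q Z∩B⊆A ⟩
        A                   ∎

module Greedy (F : OrderedField) {n : ℕ} (f : Subset n → OrderedField.R F) where
  open OrderedFieldProperties F
  open ListSums F
  open SubsetProperties
  open SubsetSums F
  open Submodularity F f

  gAux-head : ∀ acc q qs → gAux F f acc (q ∷ qs) q ≡ f (acc ∪ ⁅ q ⁆) - f acc
  gAux-head acc q qs with q ≟ q
  ... | yes _  = refl
  ... | no q≢q = contradiction refl q≢q

  gAux-tail : ∀ acc {p q} qs → p ≢ q → gAux F f acc (q ∷ qs) p ≡ gAux F f (acc ∪ ⁅ q ⁆) qs p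
  gAux-tail acc {p} {q} qs p≢q with p ≟ q
  ... | yes p≡q = contradiction p≡q p≢q
  ... | no _    = refl

  vsum-gAux-[] : ∀ acc S → (∀ {x} → x ∈ S → x ∈ˡ []) → vsum F (gAux F f acc []) S ≡ f (acc ∪ S) - f acc
  vsum-gAux-[] acc S S⊆[] = begin
    vsum F (λ _ → 0#) S  ≡⟨ sum-map-0 (elems S) ⟩
    0#                   ≡⟨ -‿inverseʳ (f acc) ⟨
    f acc - f acc        ≡⟨ cong (λ A → f A - f acc) acc∪S≡acc ⟨
    f (acc ∪ S) - f acc  ∎
    where
      open ≡-Reasoning
      acc∪S≡acc : acc ∪ S ≡ acc
      acc∪S≡acc = trans (cong (acc ∪_) (Empty-unique (λ (_ , x∈S) → ¬Any[] (S⊆[] x∈S)))) (∪-identityʳ acc)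

  vsum-gAux-∉ : ∀ acc q qs S → q ∉ S → vsum F (gAux F f acc (q ∷ qs)) S ≡ vsum F (gAux F f (acc ∪ ⁅ q ⁆) qs) S
  vsum-gAux-∉ acc q qs S q∉S = vsum-cong S (λ x∈S → gAux-tail acc qs (λ { refl → q∉S x∈S }))

  vsum-gAux-∈ : ∀ acc q qs S → q ∈ S →
    vsum F (gAux F f acc (q ∷ qs)) S ≡ (f (acc ∪ ⁅ q ⁆) - f acc) + vsum F (gAux F f (acc ∪ ⁅ q ⁆) qs) (S ∩ ∁ ⁅ q ⁆)
  vsum-gAux-∈ acc q qs S q∈S = trans (vsum-split h S ⁅ q ⁆) (cong₂ _+_ on-q off-q)
    where
      h = gAux F f acc (q ∷ qs)
      on-q : vsum F h (S ∩ ⁅ q ⁆) ≡ f (acc ∪ ⁅ q ⁆) - f acc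
      on-q = trans (cong (vsum F h) (trans (∩-comm S ⁅ q ⁆) (p⊆q⇒p∩q≡p (q∈p⇒⁅q⁆⊆p q∈S))))
                   (trans (vsum-⁅⁆ h q) (gAux-head acc q qs))
      off-q : vsum F h (S ∩ ∁ ⁅ q ⁆) ≡ vsum F (gAux F f (acc ∪ ⁅ q ⁆) qs) (S ∩ ∁ ⁅ q ⁆)
      off-q = vsum-cong (S ∩ ∁ ⁅ q ⁆) (λ x∈ → gAux-tail acc qs (x∉⁅y⁆⇒x≢y (x∈∁p⇒x∉p (proj₂ (x∈p∩q⁻ S _ x∈)))))

  gAux-telescope : ∀ acc q S → q ∈ S →
    (f (acc ∪ ⁅ q ⁆) - f acc) + (f ((acc ∪ ⁅ q ⁆) ∪ (S ∩ ∁ ⁅ q ⁆)) - f (acc ∪ ⁅ q ⁆)) ≡ f (acc ∪ S) - f acc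
  gAux-telescope acc q S q∈S = begin
    (f A′ - f acc) + (f (A′ ∪ (S ∩ ∁ ⁅ q ⁆)) - f A′)   ≡⟨ +-comm _ _ ⟩
    (f (A′ ∪ (S ∩ ∁ ⁅ q ⁆)) - f A′) + (f A′ - f acc)   ≡⟨ [x-y]+[y-z]≡x-z _ (f A′) (f acc) ⟩
    f (A′ ∪ (S ∩ ∁ ⁅ q ⁆)) - f acc                     ≡⟨ cong (λ U → f U - f acc) ([p∪⁅q⁆]∪[r∩∁⁅q⁆]≡p∪r q∈S) ⟩
    f (acc ∪ S) - f acc                                  ∎
    where
      open ≡-Reasoning
      A′ = acc ∪ ⁅ q ⁆

  _⊆ˡ_ : Subset n → List (Fin n) → Set
  S ⊆ˡ qs = ∀ {x} → x ∈ S → x ∈ˡ qs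

  private
    x∈p∩∁⁅q⁆⇒x∈p : ∀ {p : Subset n} {q x} → x ∈ p ∩ ∁ ⁅ q ⁆ → x ∈ p
    x∈p∩∁⁅q⁆⇒x∈p {p} x∈ = proj₁ (x∈p∩q⁻ p _ x∈)

    x∈p∩∁⁅q⁆⇒x≢q : ∀ {p : Subset n} {q x} → x ∈ p ∩ ∁ ⁅ q ⁆ → x ≢ q
    x∈p∩∁⁅q⁆⇒x≢q {p} x∈ = x∉⁅y⁆⇒x≢y (x∈∁p⇒x∉p (proj₂ (x∈p∩q⁻ p _ x∈)))

    x∈p⇒q∉p⇒x≢q : ∀ {p : Subset n} {q x} → x ∈ p → q ∉ p → x ≢ q
    x∈p⇒q∉p⇒x≢q x∈p q∉p refl = q∉p x∈p

    fresh-∉ : ∀ {acc S q} → q ∉ S → S ⊆ ∁ acc → S ⊆ ∁ (acc ∪ ⁅ q ⁆)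
    fresh-∉ q∉S S⊆∁acc x∈S = x∉p⇒x≢q⇒x∈∁[p∪⁅q⁆] (x∈∁p⇒x∉p (S⊆∁acc x∈S)) (x∈p⇒q∉p⇒x≢q x∈S q∉S)

    fresh-∈ : ∀ {acc S q} → S ⊆ ∁ acc → S ∩ ∁ ⁅ q ⁆ ⊆ ∁ (acc ∪ ⁅ q ⁆)
    fresh-∈ S⊆∁acc x∈ = x∉p⇒x≢q⇒x∈∁[p∪⁅q⁆] (x∈∁p⇒x∉p (S⊆∁acc (x∈p∩∁⁅q⁆⇒x∈p x∈))) (x∈p∩∁⁅q⁆⇒x≢q x∈)

    listed-∉ : ∀ {S q qs} → q ∉ S → S ⊆ˡ (q ∷ qs) → S ⊆ˡ qs
    listed-∉ q∉S S⊆qs x∈S = Any.tail (x∈p⇒q∉p⇒x≢q x∈S q∉S) (S⊆qs x∈S)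

    listed-∈ : ∀ {S q qs} → S ⊆ˡ (q ∷ qs) → (S ∩ ∁ ⁅ q ⁆) ⊆ˡ qs
    listed-∈ S⊆qs x∈ = Any.tail (x∈p∩∁⁅q⁆⇒x≢q x∈) (S⊆qs (x∈p∩∁⁅q⁆⇒x∈p x∈))

  greedy-≤ : Submodular F f → ∀ qs acc S → S ⊆ ∁ acc → S ⊆ˡ qs → vsum F (gAux F f acc qs) S ≤ f (acc ∪ S) - f acc
  greedy-≤ sub []       acc S _      S⊆qs = ≤-reflexive (vsum-gAux-[] acc S S⊆qs)
  greedy-≤ sub (q ∷ qs) acc S S⊆∁acc S⊆qs with q ∈? S
  ... | no q∉S  = begin
    vsum F (gAux F f acc (q ∷ qs)) S           ≡⟨ vsum-gAux-∉ acc q qs S q∉S ⟩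
    vsum F (gAux F f (acc ∪ ⁅ q ⁆) qs) S       ≤⟨ greedy-≤ sub qs (acc ∪ ⁅ q ⁆) S (fresh-∉ q∉S S⊆∁acc) (listed-∉ q∉S S⊆qs) ⟩
    f ((acc ∪ ⁅ q ⁆) ∪ S) - f (acc ∪ ⁅ q ⁆)    ≤⟨ diminishing-returns sub (p⊆p∪q ⁅ q ⁆) S∩[acc∪⁅q⁆]⊆acc ⟩
    f (acc ∪ S) - f acc                        ∎
    where
      open ≤-Reasoning
      S∩[acc∪⁅q⁆]⊆acc : S ∩ (acc ∪ ⁅ q ⁆) ⊆ acc
      S∩[acc∪⁅q⁆]⊆acc x∈ with x∈p∩q⁻ S _ x∈
      ... | x∈S , x∈acc∪⁅q⁆ = [ id , (λ x∈⁅q⁆ → contradiction (x∈⁅y⁆⇒x≡y q x∈⁅q⁆) (x∈p⇒q∉p⇒x≢q x∈S q∉S)) ]′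
                                   (x∈p∪q⁻ acc ⁅ q ⁆ x∈acc∪⁅q⁆)
  ... | yes q∈S = begin
    vsum F (gAux F f acc (q ∷ qs)) S
      ≡⟨ vsum-gAux-∈ acc q qs S q∈S ⟩
    (f (acc ∪ ⁅ q ⁆) - f acc) + vsum F (gAux F f (acc ∪ ⁅ q ⁆) qs) (S ∩ ∁ ⁅ q ⁆)
      ≤⟨ +-monoʳ-≤ _ (greedy-≤ sub qs (acc ∪ ⁅ q ⁆) (S ∩ ∁ ⁅ q ⁆) (fresh-∈ S⊆∁acc) (listed-∈ S⊆qs)) ⟩
    (f (acc ∪ ⁅ q ⁆) - f acc) + (f ((acc ∪ ⁅ q ⁆) ∪ (S ∩ ∁ ⁅ q ⁆)) - f (acc ∪ ⁅ q ⁆))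
      ≡⟨ gAux-telescope acc q S q∈S ⟩
    f (acc ∪ S) - f acc ∎
    where open ≤-Reasoning

  greedy-≡ : ∀ qs acc S → S ⊆ ∁ acc → S ⊆ˡ qs → All (_∈ acc ∪ S) qs → vsum F (gAux F f acc qs) S ≡ f (acc ∪ S) - f acc
  greedy-≡ []       acc S _      S⊆qs _                  = vsum-gAux-[] acc S S⊆qs
  greedy-≡ (q ∷ qs) acc S S⊆∁acc S⊆qs (q∈acc∪S ∷ qs⊆acc∪S) with q ∈? S
  ... | no q∉S  = begin
    vsum F (gAux F f acc (q ∷ qs)) S           ≡⟨ vsum-gAux-∉ acc q qs S q∉S ⟩
    vsum F (gAux F f (acc ∪ ⁅ q ⁆) qs) S       ≡⟨ greedy-≡ qs (acc ∪ ⁅ q ⁆) S (fresh-∉ q∉S S⊆∁acc) (listed-∉ q∉S S⊆qs)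
                                                    (subst (λ A → All (_∈ A ∪ S) qs) (sym acc∪⁅q⁆≡acc) qs⊆acc∪S) ⟩
    f ((acc ∪ ⁅ q ⁆) ∪ S) - f (acc ∪ ⁅ q ⁆)    ≡⟨ cong (λ A → f (A ∪ S) - f A) acc∪⁅q⁆≡acc ⟩
    f (acc ∪ S) - f acc                        ∎
    where
      open ≡-Reasoning
      acc∪⁅q⁆≡acc : acc ∪ ⁅ q ⁆ ≡ acc
      acc∪⁅q⁆≡acc = trans (∪-comm acc ⁅ q ⁆)
        (p⊆q⇒p∪q≡q (q∈p⇒⁅q⁆⊆p ([ id , (λ q∈S → contradiction q∈S q∉S) ]′ (x∈p∪q⁻ acc S q∈acc∪S))))
  ... | yes q∈S = begin
    vsum F (gAux F f acc (q ∷ qs)) S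
      ≡⟨ vsum-gAux-∈ acc q qs S q∈S ⟩
    (f (acc ∪ ⁅ q ⁆) - f acc) + vsum F (gAux F f (acc ∪ ⁅ q ⁆) qs) (S ∩ ∁ ⁅ q ⁆)
      ≡⟨ cong (_ +_) (greedy-≡ qs (acc ∪ ⁅ q ⁆) (S ∩ ∁ ⁅ q ⁆) (fresh-∈ S⊆∁acc) (listed-∈ S⊆qs)
                       (subst (λ A → All (_∈ A) qs) (sym ([p∪⁅q⁆]∪[r∩∁⁅q⁆]≡p∪r q∈S)) qs⊆acc∪S)) ⟩
    (f (acc ∪ ⁅ q ⁆) - f acc) + (f ((acc ∪ ⁅ q ⁆) ∪ (S ∩ ∁ ⁅ q ⁆)) - f (acc ∪ ⁅ q ⁆))
      ≡⟨ gAux-telescope acc q S q∈S ⟩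
    f (acc ∪ S) - f acc ∎
    where open ≡-Reasoning

module MoveToFront (F : OrderedField) {n : ℕ} (f : Subset n → OrderedField.R F) (P : Subset n) where
  open OrderedFieldProperties F
  open SubsetProperties
  open SubsetSums F
  open Submodularity F f
  open Greedy F f

  back : List (Fin n) → List (Fin n)
  back π = filter (λ p → ¬? (p ∈? P)) π

  gAux-++ : ∀ acc xs ys {p} → All (_∈ P) xs → (∀ {x} → x ∈ P → x ∈ˡ xs ⊎ x ∈ acc) → p ∉ P →
            gAux F f acc (xs ++ ys) p ≡ gAux F f (acc ∪ P) ys p
  gAux-++ acc []       ys {p} _ P⊆acc _ =
    cong (λ A → gAux F f A ys p) (sym (trans (∪-comm acc P) (p⊆q⇒p∪q≡q ([ (λ ()) , id ]′ ∘ P⊆acc))))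
  gAux-++ acc (x ∷ xs) ys {p} (x∈P ∷ xs⊆P) P⊆x∷xs∪acc p∉P = begin
    gAux F f acc (x ∷ xs ++ ys) p           ≡⟨ gAux-tail acc (xs ++ ys) (λ { refl → p∉P x∈P }) ⟩
    gAux F f (acc ∪ ⁅ x ⁆) (xs ++ ys) p     ≡⟨ gAux-++ (acc ∪ ⁅ x ⁆) xs ys xs⊆P P⊆xs∪acc′ p∉P ⟩
    gAux F f ((acc ∪ ⁅ x ⁆) ∪ P) ys p       ≡⟨ cong (λ A → gAux F f A ys p) (trans (∪-assoc acc ⁅ x ⁆ P) (cong (acc ∪_) (p⊆q⇒p∪q≡q (q∈p⇒⁅q⁆⊆p x∈P)))) ⟩
    gAux F f (acc ∪ P) ys p                 ∎
    where
      open ≡-Reasoning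
      P⊆xs∪acc′ : ∀ {z} → z ∈ P → z ∈ˡ xs ⊎ z ∈ acc ∪ ⁅ x ⁆
      P⊆xs∪acc′ z∈P with P⊆x∷xs∪acc z∈P
      ... | inj₁ (here refl)  = inj₂ (x∈p∪q⁺ (inj₂ (x∈⁅x⁆ _)))
      ... | inj₁ (there z∈xs) = inj₁ z∈xs
      ... | inj₂ z∈acc        = inj₂ (x∈p∪q⁺ (inj₁ z∈acc))

  -- Moving P to the front only enlarges the prefix before p, so its marginal can only drop.
  gAux-back-antitone : Submodular F f → ∀ qs {acc acc′ p} → p ∉ P → p ∉ acc′ → acc ⊆ acc′ → P ⊆ acc′ →
                       gAux F f acc′ (back qs) p ≤ gAux F f acc qs p
  gAux-back-antitone sub []       _   _    _        _       = ≤-refl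
  gAux-back-antitone sub (q ∷ qs) {acc} {acc′} {p} p∉P p∉acc′ acc⊆acc′ P⊆acc′ with q ∈? P
  ... | yes q∈P = subst (_ ≤_) (sym (gAux-tail acc qs (λ { refl → p∉P q∈P })))
                    (gAux-back-antitone sub qs p∉P p∉acc′ acc∪⁅q⁆⊆acc′ P⊆acc′)
    where
      acc∪⁅q⁆⊆acc′ : acc ∪ ⁅ q ⁆ ⊆ acc′
      acc∪⁅q⁆⊆acc′ x∈ = [ acc⊆acc′ , P⊆acc′ ∘ q∈p⇒⁅q⁆⊆p q∈P ]′ (x∈p∪q⁻ acc ⁅ q ⁆ x∈)
  ... | no q∉P with p ≟ q
  ...   | yes refl = diminishing-returns sub acc⊆acc′ ⁅p⁆∩acc′⊆acc
    where
      ⁅p⁆∩acc′⊆acc : ⁅ p ⁆ ∩ acc′ ⊆ acc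
      ⁅p⁆∩acc′⊆acc x∈ with x∈p∩q⁻ ⁅ p ⁆ acc′ x∈
      ... | x∈⁅p⁆ , x∈acc′ = contradiction (subst (_∈ acc′) (x∈⁅y⁆⇒x≡y p x∈⁅p⁆) x∈acc′) p∉acc′
  ...   | no p≢q = gAux-back-antitone sub qs p∉P (x∈∁p⇒x∉p (x∉p⇒x≢q⇒x∈∁[p∪⁅q⁆] p∉acc′ p≢q))
                     (λ x∈ → [ x∈p∪q⁺ ∘ inj₁ ∘ acc⊆acc′ , x∈p∪q⁺ ∘ inj₂ ]′ (x∈p∪q⁻ acc ⁅ q ⁆ x∈))
                     (x∈p∪q⁺ ∘ inj₁ ∘ P⊆acc′)

  module _ {π : List (Fin n)} (complete : ∀ x → x ∈ˡ π) where

    g-moveFront : ∀ {p} → p ∉ P → g F f (moveFront P π) p ≡ gAux F f P (back π) p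
    g-moveFront {p} p∉P = trans
      (gAux-++ ⊥ (filter (_∈? P) π) (back π) (all-filter (_∈? P) π) (λ x∈P → inj₁ (∈-filter⁺ (_∈? P) (complete _) x∈P)) p∉P)
      (cong (λ A → gAux F f A (back π) p) (∪-identityˡ P))

    back-listed : ∀ {S} → S ⊆ ∁ P → S ⊆ˡ back π
    back-listed S⊆∁P x∈S = ∈-filter⁺ (λ p → ¬? (p ∈? P)) (complete _) (x∈∁p⇒x∉p (S⊆∁P x∈S))

    moveFront-≤-contract : Submodular F f → ∀ S → S ⊆ ∁ P → vsum F (g F f (moveFront P π)) S ≤ contract F f P S
    moveFront-≤-contract sub S S⊆∁P = begin
      vsum F (g F f (moveFront P π)) S    ≡⟨ vsum-cong S (λ x∈S → g-moveFront (x∈∁p⇒x∉p (S⊆∁P x∈S))) ⟩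
      vsum F (gAux F f P (back π)) S      ≤⟨ greedy-≤ sub (back π) P S S⊆∁P (back-listed S⊆∁P) ⟩
      f (P ∪ S) - f P                     ≡⟨ cong (λ U → f U - f P) (∪-comm P S) ⟩
      contract F f P S                    ∎
      where open ≤-Reasoning

    moveFront-≡-contract : vsum F (g F f (moveFront P π)) (∁ P) ≡ contract F f P (∁ P)
    moveFront-≡-contract = begin
      vsum F (g F f (moveFront P π)) (∁ P)   ≡⟨ vsum-cong (∁ P) (λ x∈∁P → g-moveFront (x∈∁p⇒x∉p x∈∁P)) ⟩
      vsum F (gAux F f P (back π)) (∁ P)     ≡⟨ greedy-≡ (back π) P (∁ P) id (back-listed id) (All.universal (λ _ → ∈P∪∁P) _) ⟩
      f (P ∪ ∁ P) - f P                      ≡⟨ cong (λ U → f U - f P) (∪-comm P (∁ P)) ⟩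
      contract F f P (∁ P)                   ∎
      where
        open ≡-Reasoning
        ∈P∪∁P : ∀ {x} → x ∈ P ∪ ∁ P
        ∈P∪∁P = subst (_ ∈_) (sym (∪-inverseʳ P)) ∈⊤

    g-moveFront-≤ : Submodular F f → ∀ {p} → p ∉ P → g F f (moveFront P π) p ≤ g F f π p
    g-moveFront-≤ sub p∉P = subst (_≤ _) (sym (g-moveFront p∉P))
      (gAux-back-antitone sub π p∉P p∉P (⊆-min P) id)

module Thresholds (F : OrderedField) {n : ℕ} where
  open OrderedFieldProperties F
  open ListSums F
  open MinSum F
  open SubsetProperties
  open SubsetSums F

  negSum≡minSum : ∀ U (y : Fin n → R) ℓ → negSum F U y ℓ ≡ minSum ℓ (map (λ p → y p ⊓ 0#) (elems U))
  negSum≡minSum U y ℓ = sum-take-sort≡minSum _ (All-map⁺ (All.universal (λ p → x⊓y≤y (y p) 0#) _)) ℓ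

  negSum≤vsum : ∀ {U T} (y : Fin n → R) ℓ → T ⊆ U → ∣ T ∣ ℕ.≤ ℓ → negSum F U y ℓ ≤ vsum F y T
  negSum≤vsum {U} {T} y ℓ T⊆U ∣T∣≤ℓ = begin
    negSum F U y ℓ                     ≡⟨ negSum≡minSum U y ℓ ⟩
    minSum ℓ (map y⁻ (elems U))        ≤⟨ minSum-antitone (⊑-map⁺ y⁻ (elems-⊆ T⊆U)) ℓ ⟩
    minSum ℓ (map y⁻ (elems T))        ≤⟨ minSum≤sum ℓ _ (subst (ℕ._≤ ℓ) (sym (trans (length-map y⁻ (elems T)) (length-elems T))) ∣T∣≤ℓ) ⟩
    sumL (map y⁻ (elems T))            ≤⟨ sum-map-mono (All.universal (λ p → x⊓y≤x (y p) 0#) (elems T)) ⟩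
    vsum F y T                         ∎
    where
      open ≤-Reasoning
      y⁻ = λ p → y p ⊓ 0#

  negSum-perturb : ∀ {U U′} (y z : Fin n → R) ℓ → U′ ⊆ U → (∀ {p} → p ∈ U′ → z p ≤ y p) →
                   negSum F U y ℓ ≤ negSum F U′ z ℓ + vsum F (λ p → y p - z p) U′
  negSum-perturb {U} {U′} y z ℓ U′⊆U z≤y = begin
    negSum F U y ℓ                                               ≡⟨ negSum≡minSum U y ℓ ⟩
    minSum ℓ (map y⁻ (elems U))                                  ≤⟨ minSum-antitone (⊑-map⁺ y⁻ (elems-⊆ U′⊆U)) ℓ ⟩
    minSum ℓ (map y⁻ (elems U′))                                 ≤⟨ minSum-perturb y⁻ z⁻ (λ p → y p - z p)
                                                                      (All.map (y≤x⇒x⊓0≤[y⊓0]+[x-y] ∘ z≤y) All-elems)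
                                                                      (All.map (x≤y⇒0≤y-x ∘ z≤y) All-elems) ℓ ⟩
    minSum ℓ (map z⁻ (elems U′)) + vsum F (λ p → y p - z p) U′   ≡⟨ cong (_+ _) (negSum≡minSum U′ z ℓ) ⟨
    negSum F U′ z ℓ + vsum F (λ p → y p - z p) U′                ∎
    where
      open ≤-Reasoning
      y⁻ = λ p → y p ⊓ 0#
      z⁻ = λ p → z p ⊓ 0#

  minVal≤ : ∀ U (h : Subset n → R) {T} → T ⊆ U → minVal F U h ≤ h T
  minVal≤ U h {T} T⊆U = foldr-⊓≤ (subsetsOf U) (∈-filter⁺ (_⊆? U) (∈-allSubsets T) T⊆U)
    where
      ∈-allSubsets : ∀ {m} (T : Subset m) → T ∈ˡ allSubsets m
      ∈-allSubsets []            = here refl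
      ∈-allSubsets (outside ∷ T) = ∈-++⁺ˡ (∈-map⁺ (outside ∷_) (∈-allSubsets T))
      ∈-allSubsets (inside ∷ T)  = ∈-++⁺ʳ (map (outside ∷_) (allSubsets _)) (∈-map⁺ (inside ∷_) (∈-allSubsets T))
      foldr-⊓≤ : ∀ Ts → T ∈ˡ Ts → foldr (λ S r → h S ⊓ r) (h ⊥) Ts ≤ h T
      foldr-⊓≤ (S ∷ Ts) (here refl)  = x⊓y≤x _ _
      foldr-⊓≤ (S ∷ Ts) (there T∈Ts) = ≤-trans (x⊓y≤y _ _) (foldr-⊓≤ Ts T∈Ts)

  ≤minVal : ∀ U (h : Subset n → R) {c} → (∀ T → c ≤ h T) → c ≤ minVal F U h
  ≤minVal U h {c} c≤h = foldr-≤⊓ (subsetsOf U)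
    where
      foldr-≤⊓ : ∀ Ts → c ≤ foldr (λ S r → h S ⊓ r) (h ⊥) Ts
      foldr-≤⊓ []       = c≤h ⊥
      foldr-≤⊓ (S ∷ Ts) = ⊓-glb (c≤h S) (foldr-≤⊓ Ts)

module Contraction (F : OrderedField) where
  open OrderedFieldProperties F

  module MovedVector {n : ℕ} (f : Subset n → R) (sub : Submodular F f)
                     (P : Subset n) {m : ℕ} (α : Fin m → R) (π : Fin m → List (Fin n))
                     (0≤α : ∀ t → 0# ≤ α t) (Σα≡1 : fsum F α ≡ 1#) (complete : ∀ t x → x ∈ˡ π t) where
    open ListSums F
    open SubsetSums F
    open MoveToFront F f P

    moved : Fin n → R
    moved p = fsum F (λ t → α t * g F f (moveFront P (π t)) p)

    moved-inBase : InBase F (∁ P) (contract F f P) moved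
    moved-inBase = feasible , tight
      where
        feasible : ∀ S → S ⊆ ∁ P → vsum F moved S ≤ contract F f P S
        feasible S S⊆∁P = subst (_≤ _) (sym (vsum-linear α (λ t → g F f (moveFront P (π t))) S))
          (convex-≤ α _ 0≤α Σα≡1 (λ t → moveFront-≤-contract (complete t) sub S S⊆∁P))
        tight : vsum F moved (∁ P) ≡ contract F f P (∁ P)
        tight = trans (vsum-linear α (λ t → g F f (moveFront P (π t))) (∁ P))
          (convex-≡ α _ Σα≡1 (λ t → moveFront-≡-contract (complete t)))

    moved-≤ : ∀ {p} → p ∉ P → moved p ≤ fsum F (λ t → α t * g F f (π t) p)
    moved-≤ p∉P = sum-map-mono (All.universal (λ t → *-monoʳ-≤-nonneg (α t) (0≤α t) (g-moveFront-≤ (complete t) sub p∉P)) (allFin m))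

  module SparseCertificate {n : ℕ} (f : Subset n → R) (P : Subset n)
                           (δ : R) (k : ℕ) (y : Fin n → R) (y-tight : vsum F y ⊤ ≡ f ⊤) (cert : DualCert F ⊤ f δ k y)
                           (S* : Subset n) (S*-min : SparseMin F k f S*) (P⊆S* : P ⊆ S*) where
    open SubsetProperties
    open SubsetSums F
    open Thresholds F

    N : R
    N = negSum F ⊤ y (suc k)

    T : Subset n
    T = S* ∩ ∁ P

    f[S*]≤N+δ : f S* ≤ N + δ
    f[S*]≤N+δ = ≤-trans (≤minVal ⊤ f (proj₂ S*-min)) (proj₁ cert)

    N≤y[T] : N ≤ vsum F y T
    N≤y[T] = negSum≤vsum y (suc k) ⊆⊤ (ℕₚ.≤-trans (∣p∩q∣≤∣p∣ S* (∁ P)) (ℕₚ.m≤n⇒m≤1+n (proj₁ S*-min)))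

    y[S*]≡y[P]+y[T] : vsum F y S* ≡ vsum F y P + vsum F y T
    y[S*]≡y[P]+y[T] = trans (vsum-split y S* P) (cong (λ U → vsum F y U + vsum F y T) (trans (∩-comm S* P) (p⊆q⇒p∩q≡p P⊆S*)))

    y[P]≤δ : vsum F y P ≤ δ
    y[P]≤δ = +-cancelʳ-≤ N (begin
      vsum F y P + N             ≤⟨ +-monoʳ-≤ _ N≤y[T] ⟩
      vsum F y P + vsum F y T    ≡⟨ y[S*]≡y[P]+y[T] ⟨
      vsum F y S*                ≤⟨ proj₂ cert S* ⊆⊤ (proj₁ S*-min) ⟩
      f S*                       ≤⟨ f[S*]≤N+δ ⟩
      N + δ                      ≡⟨ +-comm N δ ⟩
      δ + N                      ∎)
      where open ≤-Reasoning

    module _ (z : Fin n → R) (z≤y : ∀ {p} → p ∈ ∁ P → z p ≤ y p) (z-base : InBase F (∁ P) (contract F f P) z) where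

      y[∁P]≡f[V]-y[P] : vsum F y (∁ P) ≡ f ⊤ - vsum F y P
      y[∁P]≡f[V]-y[P] = begin
        vsum F y (∁ P)                          ≡⟨ //-rightDividesʳ (vsum F y P) _ ⟨
        (vsum F y (∁ P) + vsum F y P) - vsum F y P  ≡⟨ cong (_- vsum F y P) (+-comm _ _) ⟩
        (vsum F y P + vsum F y (∁ P)) - vsum F y P  ≡⟨ cong (_- vsum F y P) split-V ⟨
        vsum F y ⊤ - vsum F y P                 ≡⟨ cong (_- vsum F y P) y-tight ⟩
        f ⊤ - vsum F y P                        ∎
        where
          open ≡-Reasoning
          split-V : vsum F y ⊤ ≡ vsum F y P + vsum F y (∁ P)
          split-V = trans (vsum-split y ⊤ P) (cong₂ (λ U V → vsum F y U + vsum F y V) (∩-identityˡ P) (∩-identityˡ (∁ P)))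

      vsum[y-z]≡f[P]-y[P] : vsum F (λ p → y p - z p) (∁ P) ≡ f P - vsum F y P
      vsum[y-z]≡f[P]-y[P] = begin
        vsum F (λ p → y p - z p) (∁ P)          ≡⟨ vsum-sub y z (∁ P) ⟩
        vsum F y (∁ P) - vsum F z (∁ P)         ≡⟨ cong₂ _-_ y[∁P]≡f[V]-y[P] (trans (proj₂ z-base) (cong (λ U → f U - f P) (∪-inverseˡ P))) ⟩
        (f ⊤ - vsum F y P) - (f ⊤ - f P)        ≡⟨ [x-y]-[x-z]≡z-y (f ⊤) (vsum F y P) (f P) ⟩
        f P - vsum F y P                        ∎
        where open ≡-Reasoning

      contracted-threshold : minVal F (∁ P) (contract F f P) ≤ negSum F (∁ P) z (suc k) + (δ - vsum F y P)
      contracted-threshold = begin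
        minVal F (∁ P) (contract F f P)                     ≤⟨ minVal≤ (∁ P) (contract F f P) (p∩q⊆q S* (∁ P)) ⟩
        f (T ∪ P) - f P                                     ≡⟨ cong (λ U → f U - f P) (trans (∪-comm T P) (p⊆q⇒p∪[q∩∁p]≡q P⊆S*)) ⟩
        f S* - f P                                          ≤⟨ +-monoˡ-≤ (- f P) (≤-trans f[S*]≤N+δ (+-monoˡ-≤ δ N≤N′+[y-z][∁P])) ⟩
        ((N′ + vsum F (λ p → y p - z p) (∁ P)) + δ) - f P   ≡⟨ cong (λ e → ((N′ + e) + δ) - f P) vsum[y-z]≡f[P]-y[P] ⟩
        ((N′ + (f P - vsum F y P)) + δ) - f P               ≡⟨ [x+[y-z]+w]-y≡x+[w-z] N′ (f P) (vsum F y P) δ ⟩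
        N′ + (δ - vsum F y P)                               ∎
        where
          open ≤-Reasoning
          N′ = negSum F (∁ P) z (suc k)
          N≤N′+[y-z][∁P] : N ≤ N′ + vsum F (λ p → y p - z p) (∁ P)
          N≤N′+[y-z][∁P] = negSum-perturb y z (suc k) ⊆⊤ z≤y

      contracted-certificate : (vsum F y P ≤ δ) × DualCert F (∁ P) (contract F f P) (δ - vsum F y P) k z
      contracted-certificate = y[P]≤δ , contracted-threshold , λ S S⊆∁P _ → proj₁ z-base S S⊆∁P

lemma4p9 : (F : OrderedField) → let open OrderedField F in
    (n : ℕ) (f : Subset n → R) → Submodular F f → f ⊥ ≡ 0# →
    (δ : R) (k : ℕ) (y : Fin n → R) →
    InBase F ⊤ f y → DualCert F ⊤ f δ k y →
    (m : ℕ) (α : Fin m → R) (π : Fin m → List (Fin n)) →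
    (∀ t → 0# ≤ α t) → fsum F α ≡ 1# → (∀ t → π t ↭ allFin n) →
    (∀ p → y p ≡ fsum F (λ t → α t * g F f (π t) p)) →
    (P : Subset n) →
    let yP = λ p → fsum F (λ t → α t * g F f (moveFront P (π t)) p)
        fP = contract F f P
    in InBase F (∁ P) fP yP ×
       ((S* : Subset n) → SparseMin F k f S* → P ⊆ S* →
          (vsum F y P ≤ δ) × DualCert F (∁ P) fP (δ - vsum F y P) k yP)
lemma4p9 F n f sub _ δ k y (_ , y-tight) cert m α π 0≤α Σα≡1 π↭allFin y≡ P =
  moved-inBase , λ S* S*-min P⊆S* →
    SparseCertificate.contracted-certificate f P δ k y y-tight cert S* S*-min P⊆S* moved moved≤y moved-inBase
  where
    open OrderedField F using (_≤_)
    complete : ∀ t x → x ∈ˡ π t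
    complete t x = ∈-resp-↭ (↭-sym (π↭allFin t)) (∈-allFin x)
    open Contraction F
    open MovedVector f sub P α π 0≤α Σα≡1 complete
    moved≤y : ∀ {p} → p ∈ ∁ P → moved p ≤ y p
    moved≤y {p} p∈∁P = subst (moved p ≤_) (sym (y≡ p)) (moved-≤ (x∈∁p⇒x∉p p∈∁P))
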